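{- For all integers $N\geq 1$ and $n\geq 0$, $$c\phi_{3N}(3n+2)\equiv 0 \pmod{3}.$$
   Context: For an integer $k\geq 1$, $c\phi_k(n)$ denotes Andrews' number of $k$-colored generalized Frobenius partitions of $n$: the number of two-rowed arrays $\begin{pmatrix} a_1 & \cdots & a_s\\ b_1 & \cdots & b_s\end{pmatrix}$ ($s\geq 0$) whose entries are nonnegative integers each carrying one of $k$ colors, where each row consists of distinct colored integers listed in strictly decreasing order (colored integers being ordered first by value and then by color index), and $n = s+\sum_i a_i+\sum_i b_i$. Equivalently, $\sum_{n\geq 0} c\phi_k(n)q^n$ is the coefficient of $z^0$ in $\prod_{m=0}^\infty (1+zq^{m+1})^k(1+z^{ -1}q^m)^k$. -}

module Defs where

open import Data.Nat using (ℕ; zero; suc; _+_; _*_; _≡ᵇ_)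
open import Data.Bool using (Bool; true; false; if_then_else_; _∧_)
open import Data.Fin using (Fin)
open import Data.List using (List; []; _∷_; _++_; map; concatMap; length; upTo; allFin)
open import Data.Nat.ListAction using (sum)
open import Data.Product using (_×_; _,_; proj₁)

Colored : ℕ → Set
Colored k = ℕ × Fin k

coloredUpTo : (k n : ℕ) → List (Colored k)
coloredUpTo k n = concatMap (λ a → map (λ c → (a , c)) (allFin k)) (upTo (suc n))

sublists : {A : Set} → List A → List (List A)
sublists []       = [] ∷ []
sublists (x ∷ xs) = let r = sublists xs in r ++ map (x ∷_) r

-- A row of a generalized Frobenius symbol is a finite set of distinct colored
-- integers written in strictly decreasing order; equivalently (listing it in
-- increasing order instead) a subsequence of the strictly increasing list of all
-- colored integers.  Since every entry of an array counted by cφ_k(n) is ≤ n,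
-- it suffices to take subsequences of coloredUpTo k n.
rows : (k n : ℕ) → List (List (Colored k))
rows k n = sublists (coloredUpTo k n)

weight : {k : ℕ} → List (Colored k) → ℕ
weight r = sum (map proj₁ r)

count : {A : Set} → (A → Bool) → List A → ℕ
count p []       = 0
count p (x ∷ xs) = (if p x then 1 else 0) + count p xs

cφ : (k n : ℕ) → ℕ
cφ k n = sum (map (λ top → count (valid top) (rows k n)) (rows k n))
  where
  valid : List (Colored k) → List (Colored k) → Bool
  valid top bot = (length top ≡ᵇ length bot)
                ∧ ((length top + weight top + weight bot) ≡ᵇ n)

{-# OPTIONS --safe #-}
module Submission where

-- Write a sum over pairs of rows as Σ_t h(|t|, weight t), t ranging over
-- the sublists of the list L of colored integers of value ≤ n.  With 3N colors, L
-- splits into triples (v,c₁),(v,c₂),(v,c₃) of equal value, and choosing j of the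
-- three adds (j, j v) to (|t|, weight t) in C(3,j) ways.  The middle terms carry
-- the factor 3, and the extreme terms shift (|t|, weight t) by multiples of 3; so
-- 3 divides the sum whenever h(s,w) is divisible by 3 for s, w ≡ 0 (mod 3).
-- Applied twice (top row, then bottom row) this reduces the claim to: an array
-- with s, Σaᵢ, Σbᵢ all ≡ 0 (mod 3) cannot have size s + Σaᵢ + Σbᵢ = 3n + 2.

open import Defs
open import Data.Nat using (ℕ; zero; suc; _+_; _*_; _≤_; _%_; _≡ᵇ_; s≤s)
open import Data.Nat.Properties using (≡ᵇ⇒≡; *-suc; suc-injective; +-identityʳ)
open import Data.Nat.Divisibility
  using (_∣_; divides; ∣m∣n⇒∣m+n; ∣m+n∣m⇒∣n; m∣m*n; n∣m⇒m%n≡0; ∣⇒≤)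
open import Data.Nat.ListAction using (sum)
open import Data.Nat.ListAction.Properties using (sum-++)
open import Data.Nat.Tactic.RingSolver using (solve-∀)
open import Data.Bool using (Bool; true; false; if_then_else_; _∧_; T)
open import Data.Bool.Properties using (∧-zeroʳ)
open import Data.List using (List; []; _∷_; _++_; map; length; upTo; allFin; concatMap)
open import Data.List.Properties using (map-++; map-∘; map-cong; length-tabulate)
open import Data.Fin using (Fin)
open import Data.Product using (_,_; proj₁)
open import Relation.Nullary using (¬_)
open import Relation.Binary.PropositionalEquality
  using (_≡_; refl; sym; trans; cong; cong₂; subst; module ≡-Reasoning)

open ≡-Reasoning

sum-map-++ : {A : Set} (f : A → ℕ) (xs ys : List A) →
             sum (map f (xs ++ ys)) ≡ sum (map f xs) + sum (map f ys)
sum-map-++ f xs ys = trans (cong sum (map-++ f xs ys)) (sum-++ (map f xs) (map f ys))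

count≡sum-indicator : {A : Set} (p : A → Bool) (xs : List A) →
                      count p xs ≡ sum (map (λ x → if p x then 1 else 0) xs)
count≡sum-indicator p []       = refl
count≡sum-indicator p (x ∷ xs) = cong ((if p x then 1 else 0) +_) (count≡sum-indicator p xs)

3∤3n+2 : ∀ n → ¬ 3 ∣ 3 * n + 2
3∤3n+2 n 3∣3n+2 with ∣⇒≤ (∣m+n∣m⇒∣n 3∣3n+2 (m∣m*n n))
... | s≤s (s≤s ())

sublistSum : {k : ℕ} → List (Colored k) → (ℕ → ℕ → ℕ) → ℕ
sublistSum L h = sum (map (λ t → h (length t) (weight t)) (sublists L))

-- The effect on h of adjoining one element of value v to every sublist.
shift : ℕ → (ℕ → ℕ → ℕ) → ℕ → ℕ → ℕ
shift v h s w = h (suc s) (v + w)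

sublistSum-∷ : {k : ℕ} (x : Colored k) (xs : List (Colored k)) (h : ℕ → ℕ → ℕ) →
               sublistSum (x ∷ xs) h ≡ sublistSum xs h + sublistSum xs (shift (proj₁ x) h)
sublistSum-∷ x xs h = begin
  sum (map f (r ++ map (x ∷_) r))              ≡⟨ sum-map-++ f r (map (x ∷_) r) ⟩
  sum (map f r) + sum (map f (map (x ∷_) r))   ≡⟨ cong (λ l → sum (map f r) + sum l) (map-∘ r) ⟨
  sublistSum xs h + sublistSum xs (shift (proj₁ x) h) ∎
  where
  r : List (List (Colored _))
  r = sublists xs
  f : List (Colored _) → ℕ
  f t = h (length t) (weight t)

sublistSum-triple : {k : ℕ} (v : ℕ) (c₁ c₂ c₃ : Fin k) (r : List (Colored k)) (h : ℕ → ℕ → ℕ) →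
  sublistSum ((v , c₁) ∷ (v , c₂) ∷ (v , c₃) ∷ r) h
    ≡ sublistSum r h + sublistSum r (shift v (shift v (shift v h)))
      + 3 * (sublistSum r (shift v h) + sublistSum r (shift v (shift v h)))
sublistSum-triple v c₁ c₂ c₃ r h = begin
  S ((v , c₁) ∷ (v , c₂) ∷ (v , c₃) ∷ r) h
    ≡⟨ sublistSum-∷ (v , c₁) ((v , c₂) ∷ (v , c₃) ∷ r) h ⟩
  S ((v , c₂) ∷ (v , c₃) ∷ r) h + S ((v , c₂) ∷ (v , c₃) ∷ r) (shift v h)
    ≡⟨ cong₂ _+_ (pair h) (pair (shift v h)) ⟩
  S₀ + S₁ + (S₁ + S₂) + (S₁ + S₂ + (S₂ + S₃))
    ≡⟨ rearrange S₀ S₁ S₂ S₃ ⟩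
  S₀ + S₃ + 3 * (S₁ + S₂) ∎
  where
  S : List (Colored _) → (ℕ → ℕ → ℕ) → ℕ
  S = sublistSum
  S₀ S₁ S₂ S₃ : ℕ
  S₀ = S r h
  S₁ = S r (shift v h)
  S₂ = S r (shift v (shift v h))
  S₃ = S r (shift v (shift v (shift v h)))
  pair : ∀ g → S ((v , c₂) ∷ (v , c₃) ∷ r) g ≡ S r g + S r (shift v g) + (S r (shift v g) + S r (shift v (shift v g)))
  pair g = trans (sublistSum-∷ (v , c₂) ((v , c₃) ∷ r) g)
                 (cong₂ _+_ (sublistSum-∷ (v , c₃) r g) (sublistSum-∷ (v , c₃) r (shift v g)))
  rearrange : ∀ a b c d → a + b + (b + c) + (b + c + (c + d)) ≡ a + d + 3 * (b + c)
  rearrange = solve-∀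

data Triples {k : ℕ} : List (Colored k) → Set where
  []     : Triples []
  triple : ∀ {v c₁ c₂ c₃ r} → Triples r → Triples ((v , c₁) ∷ (v , c₂) ∷ (v , c₃) ∷ r)

3∣-Closed : (ℕ → ℕ → ℕ) → Set
3∣-Closed h = ∀ s w → 3 ∣ s → 3 ∣ w → 3 ∣ h s w

shift³-3∣-Closed : ∀ v {h} → 3∣-Closed h → 3∣-Closed (shift v (shift v (shift v h)))
shift³-3∣-Closed v {h} closed s w (divides a refl) (divides b refl) =
  subst (λ m → 3 ∣ h (3 + a * 3) m) (sym (three-v+w v (b * 3)))
    (closed (3 + a * 3) (3 * v + b * 3) (divides (suc a) refl)
      (∣m∣n⇒∣m+n (m∣m*n v) (divides b refl)))
  where
  three-v+w : ∀ v w → v + (v + (v + w)) ≡ 3 * v + w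
  three-v+w = solve-∀

3∣sublistSum : {k : ℕ} {L : List (Colored k)} → Triples L →
               ∀ {h} → 3∣-Closed h → 3 ∣ sublistSum L h
3∣sublistSum [] {h} closed =
  subst (3 ∣_) (sym (+-identityʳ (h 0 0))) (closed 0 0 (divides 0 refl) (divides 0 refl))
3∣sublistSum (triple {v} {c₁} {c₂} {c₃} {r} ts) {h} closed =
  subst (3 ∣_) (sym (sublistSum-triple v c₁ c₂ c₃ r h))
    (∣m∣n⇒∣m+n (∣m∣n⇒∣m+n (3∣sublistSum ts closed) (3∣sublistSum ts (shift³-3∣-Closed v closed)))
               (m∣m*n (sublistSum r (shift v h) + sublistSum r (shift v (shift v h)))))

Triples-++ : {k : ℕ} {xs ys : List (Colored k)} → Triples xs → Triples ys → Triples (xs ++ ys)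
Triples-++ []           tys = tys
Triples-++ (triple txs) tys = triple (Triples-++ txs tys)

Triples-sameValue : {k : ℕ} (v m : ℕ) (cs : List (Fin k)) → length cs ≡ 3 * m →
                    Triples (map (v ,_) cs)
Triples-sameValue v m       []                    _ = []
Triples-sameValue v zero    (_ ∷ _)               ()
Triples-sameValue v (suc m) (_ ∷ [])              eq with () ← suc-injective (trans eq (*-suc 3 m))
Triples-sameValue v (suc m) (_ ∷ _ ∷ [])          eq with () ← suc-injective (suc-injective (trans eq (*-suc 3 m)))
Triples-sameValue v (suc m) (_ ∷ _ ∷ _ ∷ cs) eq =
  triple (Triples-sameValue v m cs (suc-injective (suc-injective (suc-injective (trans eq (*-suc 3 m))))))

Triples-concatMap : {k : ℕ} (f : ℕ → List (Colored k)) (xs : List ℕ) →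
                    (∀ a → Triples (f a)) → Triples (concatMap f xs)
Triples-concatMap f []       _  = []
Triples-concatMap f (x ∷ xs) tf = Triples-++ (tf x) (Triples-concatMap f xs tf)

Triples-coloredUpTo : (N n : ℕ) → Triples (coloredUpTo (3 * N) n)
Triples-coloredUpTo N n = Triples-concatMap _ (upTo (suc n))
  (λ v → Triples-sameValue v N (allFin (3 * N)) (length-tabulate (λ i → i)))

isArrayOfSize : ℕ → ℕ → ℕ → ℕ → ℕ → ℕ
isArrayOfSize n s w s′ w′ = if (s ≡ᵇ s′) ∧ (s + w + w′ ≡ᵇ n) then 1 else 0

cφ≡sublistSum : (k n : ℕ) →
  cφ k n ≡ sublistSum (coloredUpTo k n) (λ s w → sublistSum (coloredUpTo k n) (isArrayOfSize n s w))
cφ≡sublistSum k n = cong sum (map-cong (λ _ → count≡sum-indicator _ (rows k n)) (rows k n))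

corollary2p5 : (N n : ℕ) → 1 ≤ N → cφ (3 * N) (3 * n + 2) % 3 ≡ 0
corollary2p5 N n _ = n∣m⇒m%n≡0 _ 3
  (subst (3 ∣_) (sym (cφ≡sublistSum (3 * N) M)) (3∣sublistSum triples bottomRowsClosed))
  where
  M : ℕ
  M = 3 * n + 2
  triples : Triples (coloredUpTo (3 * N) M)
  triples = Triples-coloredUpTo N M
  bottomRowsClosed : 3∣-Closed (λ s w → sublistSum (coloredUpTo (3 * N) M) (isArrayOfSize M s w))
  bottomRowsClosed s w 3∣s 3∣w = 3∣sublistSum triples indicatorClosed
    where
    indicatorClosed : 3∣-Closed (isArrayOfSize M s w)
    indicatorClosed s′ w′ _ 3∣w′ with s + w + w′ ≡ᵇ M in size≡M
    ... | false rewrite ∧-zeroʳ (s ≡ᵇ s′) = divides 0 refl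
    ... | true with () ← 3∤3n+2 n (subst (3 ∣_) (≡ᵇ⇒≡ _ _ (subst T (sym size≡M) _))
                                   (∣m∣n⇒∣m+n (∣m∣n⇒∣m+n 3∣s 3∣w) 3∣w′))
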